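{- Let $\mathcal{I}=(G,S,T,k)$ be an instance of \textsc{Token Jumping} and let $J$ be the subgraph of $G$ induced by $N_G[S\cup T]$. If $J$ is $\{C_3,C_4\}$-free and contains a vertex of degree (in $J$) at least $3k$, then $\mathcal{I}$ is a yes-instance. Moreover, the length of a shortest reconfiguration sequence from $S$ to $T$ is at most $2k$.
   Context: \textsc{Token Jumping}: given a graph $G$ and independent sets $S,T$ with $|S|=|T|=k\ge1$, decide whether there is a reconfiguration sequence $S=S_0,\dots,S_\ell=T$ of size-$k$ independent sets with $|S_i\,\Delta\,S_{i+1}|=2$ for all $i$; its length is $\ell$. $N_G[X]$ is the closed neighborhood of $X$. $\{C_3,C_4\}$-free means no induced cycle of length $3$ or $4$. -}

module Defs where

open import Data.Nat using (ℕ; zero; suc; _+_; _*_; _≤_)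
open import Data.Fin using (Fin; zero; suc)
open import Data.Fin.Subset using (Subset; _∈_; _∉_; _∪_; _∩_; _─_; ∣_∣)
open import Data.Bool using (Bool; true; false; _∨_; _∧_; T)
open import Data.Vec using (tabulate; lookup)
open import Data.Product using (_×_; ∃; ∃-syntax)
open import Relation.Nullary using (¬_)
open import Relation.Binary.PropositionalEquality using (_≡_; _≢_)

record Graph (n : ℕ) : Set where
  field
    adj     : Fin n → Fin n → Bool
    sym     : ∀ u v → adj u v ≡ adj v u
    irrefl  : ∀ v → adj v v ≡ false
open Graph public

module _ {n : ℕ} (G : Graph n) where

  Adj : Fin n → Fin n → Set
  Adj u v = T (adj G u v)

  IndependentSet : Subset n → Set
  IndependentSet X = ∀ u v → u ∈ X → v ∈ X → ¬ Adj u v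

anyFin : ∀ {n} → (Fin n → Bool) → Bool
anyFin {zero}  f = false
anyFin {suc n} f = f zero ∨ anyFin (λ i → f (suc i))

module _ {n : ℕ} (G : Graph n) where

  nbhd : Fin n → Subset n
  nbhd v = tabulate (adj G v)

  closedNbhd : Subset n → Subset n
  closedNbhd X = tabulate λ v → lookup X v ∨ anyFin (λ u → lookup X u ∧ adj G u v)

  inducedDegree : Subset n → Fin n → ℕ
  inducedDegree W v = ∣ nbhd v ∩ W ∣

  HasInducedC3 : Subset n → Set
  HasInducedC3 W = ∃ λ a → ∃ λ b → ∃ λ c →
    a ∈ W × b ∈ W × c ∈ W ×
    a ≢ b × a ≢ c × b ≢ c ×
    Adj G a b × Adj G b c × Adj G c a

  HasInducedC4 : Subset n → Set
  HasInducedC4 W = ∃ λ a → ∃ λ b → ∃ λ c → ∃ λ d →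
    a ∈ W × b ∈ W × c ∈ W × d ∈ W ×
    a ≢ b × a ≢ c × a ≢ d × b ≢ c × b ≢ d × c ≢ d ×
    Adj G a b × Adj G b c × Adj G c d × Adj G d a ×
    ¬ Adj G a c × ¬ Adj G b d

  C3C4Free : Subset n → Set
  C3C4Free W = ¬ HasInducedC3 W × ¬ HasInducedC4 W

  _Δ_ : Subset n → Subset n → Subset n
  X Δ Y = (X ─ Y) ∪ (Y ─ X)

  TJConfig : ℕ → Subset n → Set
  TJConfig k X = IndependentSet G X × ∣ X ∣ ≡ k

  -- ReconfSeq k S T ℓ : a reconfiguration sequence S = S₀, …, S_ℓ = T of
  -- size-k independent sets with |Sᵢ Δ Sᵢ₊₁| = 2 (Token Jumping), of length ℓ.
  data ReconfSeq (k : ℕ) : Subset n → Subset n → ℕ → Set where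
    done : ∀ {S} → TJConfig k S → ReconfSeq k S S zero
    step : ∀ {S S′ T ℓ} → TJConfig k S → ∣ S Δ S′ ∣ ≡ 2 →
           ReconfSeq k S′ T ℓ → ReconfSeq k S T (suc ℓ)

{-# OPTIONS --safe #-}
module Submission where

-- Let v be the vertex of degree ≥ 3k in J and B = (S ∪ T) - v, so |B| ≤ 2k. As J has
-- no induced C₃ or C₄, every b ∈ B is, or is adjacent to, at most one neighbour of v in J:
-- two of them would close a triangle through v, or an induced 4-cycle v–x–b–y. Hence at
-- least k neighbours of v in J lie outside N[B]; they are pairwise non-adjacent (again no
-- triangle through v), so any k of them form an independent set Z with no edges to B.
-- A size-k independent X ⊆ S ∪ T reaches Z in at most k jumps: the token on v, if any,
-- jumps into Z first, and then each remaining token of X ─ Z jumps onto Z ─ X, which keeps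
-- every intermediate set independent. Going S → Z → T takes at most 2k jumps.

open import Defs hiding (sym)
open import Data.Nat using (ℕ; zero; suc; _+_; _*_; _≤_; _<_; z≤n; s≤s)
open import Data.Nat.Properties
  using ( ≤-refl; ≤-reflexive; ≤-trans; ≤-pred; ≤-<-trans; <⇒≢; <⇒≱; m≤m+n
        ; +-suc; +-comm; +-identityʳ; +-mono-≤; +-monoʳ-≤; +-cancelʳ-≡; +-cancelʳ-≤; module ≤-Reasoning )
open import Data.Fin using (Fin)
open import Data.Fin.Properties using (_≟_)
open import Data.Fin.Subset
open import Data.Fin.Subset.Properties
open import Data.Bool using (Bool; T)
open import Data.Bool.Properties using (T-≡; T-∨; T-∧)
open import Data.Vec using (_∷_; []; lookup; tabulate; here; there)
open import Data.Vec.Properties using (lookup∘tabulate; []=⇒lookup; lookup⇒[]=)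
open import Data.Product using (_×_; ∃; _,_; proj₁; proj₂)
import Data.Product as Product
open import Data.Sum using (_⊎_; inj₁; inj₂)
import Data.Sum as Sum
open import Function using (_∘_; id)
open import Function.Bundles using (Equivalence)
open import Relation.Nullary using (¬_; yes; no; contradiction)
open import Relation.Binary.PropositionalEquality
  using (_≡_; _≢_; refl; sym; trans; cong; cong₂; subst; ≢-sym; module ≡-Reasoning)

private
  variable
    n k ℓ m : ℕ
    p q r B W X Y Z : Subset n
    a b c d u v w x y : Fin n

x∈p─q⁻ : ∀ (p q : Subset n) → x ∈ p ─ q → x ∈ p × x ∉ q
x∈p─q⁻ (inside ∷ p) (outside ∷ q) here          = here , λ ()
x∈p─q⁻ (_ ∷ p)      (outside ∷ q) (there x∈p─q) = Product.map there (_∘ drop-there) (x∈p─q⁻ p q x∈p─q)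
x∈p─q⁻ (_ ∷ p)      (inside  ∷ q) (there x∈p─q) = Product.map there (_∘ drop-there) (x∈p─q⁻ p q x∈p─q)

∪-monoˡ-⊆ : p ⊆ q → p ∪ r ⊆ q ∪ r
∪-monoˡ-⊆ {p = p} {r = r} p⊆q = x∈p∪q⁺ ∘ Sum.map₁ p⊆q ∘ x∈p∪q⁻ p r

∩-monoʳ-⊆ : ∀ (p : Subset n) → q ⊆ r → p ∩ q ⊆ p ∩ r
∩-monoʳ-⊆ {q = q} p q⊆r = x∈p∩q⁺ ∘ Product.map₂ q⊆r ∘ x∈p∩q⁻ p q

∣p∪q∣+∣p∩q∣≡∣p∣+∣q∣ : ∀ (p q : Subset n) → ∣ p ∪ q ∣ + ∣ p ∩ q ∣ ≡ ∣ p ∣ + ∣ q ∣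
∣p∪q∣+∣p∩q∣≡∣p∣+∣q∣ []            []            = refl
∣p∪q∣+∣p∩q∣≡∣p∣+∣q∣ (inside  ∷ p) (inside  ∷ q) =
  cong suc (trans (+-suc _ _) (trans (cong suc (∣p∪q∣+∣p∩q∣≡∣p∣+∣q∣ p q)) (sym (+-suc _ _))))
∣p∪q∣+∣p∩q∣≡∣p∣+∣q∣ (inside  ∷ p) (outside ∷ q) = cong suc (∣p∪q∣+∣p∩q∣≡∣p∣+∣q∣ p q)
∣p∪q∣+∣p∩q∣≡∣p∣+∣q∣ (outside ∷ p) (inside  ∷ q) =
  trans (cong suc (∣p∪q∣+∣p∩q∣≡∣p∣+∣q∣ p q)) (sym (+-suc _ _))
∣p∪q∣+∣p∩q∣≡∣p∣+∣q∣ (outside ∷ p) (outside ∷ q) = ∣p∪q∣+∣p∩q∣≡∣p∣+∣q∣ p q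

∣p─q∣+∣p∩q∣≡∣p∣ : ∀ (p q : Subset n) → ∣ p ─ q ∣ + ∣ p ∩ q ∣ ≡ ∣ p ∣
∣p─q∣+∣p∩q∣≡∣p∣ []            []            = refl
∣p─q∣+∣p∩q∣≡∣p∣ (inside  ∷ p) (inside  ∷ q) = trans (+-suc _ _) (cong suc (∣p─q∣+∣p∩q∣≡∣p∣ p q))
∣p─q∣+∣p∩q∣≡∣p∣ (inside  ∷ p) (outside ∷ q) = cong suc (∣p─q∣+∣p∩q∣≡∣p∣ p q)
∣p─q∣+∣p∩q∣≡∣p∣ (outside ∷ p) (inside  ∷ q) = ∣p─q∣+∣p∩q∣≡∣p∣ p q
∣p─q∣+∣p∩q∣≡∣p∣ (outside ∷ p) (outside ∷ q) = ∣p─q∣+∣p∩q∣≡∣p∣ p q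

subset-of-size : ∀ {n} m (p : Subset n) → m ≤ ∣ p ∣ → ∃ λ q → q ⊆ p × ∣ q ∣ ≡ m
subset-of-size {n} zero _ _ = ⊥ , ⊥⊆ , ∣⊥∣≡0 n
subset-of-size (suc m) (inside  ∷ p) (s≤s m≤∣p∣) =
  Product.map (inside ∷_) (Product.map in⊆in (cong suc)) (subset-of-size m p m≤∣p∣)
subset-of-size (suc m) (outside ∷ p) m<∣p∣ =
  Product.map (outside ∷_) (Product.map out⊆ id) (subset-of-size (suc m) p m<∣p∣)

∣p∪q∣≤∣p∣+∣q∣ : ∀ (p q : Subset n) → ∣ p ∪ q ∣ ≤ ∣ p ∣ + ∣ q ∣
∣p∪q∣≤∣p∣+∣q∣ p q = subst (∣ p ∪ q ∣ ≤_) (∣p∪q∣+∣p∩q∣≡∣p∣+∣q∣ p q) (m≤m+n _ _)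

Empty⇒∣p∣≡0 : ∀ {n} {p : Subset n} → Empty p → ∣ p ∣ ≡ 0
Empty⇒∣p∣≡0 {n} empty = trans (cong ∣_∣ (Empty-unique empty)) (∣⊥∣≡0 n)

Nonempty⇒∣p∣>0 : Nonempty p → 0 < ∣ p ∣
Nonempty⇒∣p∣>0 (_ , x∈p) = ≤-<-trans z≤n (x∈p⇒∣p-x∣<∣p∣ x∈p)

∣p∣>0⇒Nonempty : 0 < ∣ p ∣ → Nonempty p
∣p∣>0⇒Nonempty {p = p} ∣p∣>0 with nonempty? p
... | yes nonempty = nonempty
... | no  empty    = contradiction (Empty⇒∣p∣≡0 empty) (≢-sym (<⇒≢ ∣p∣>0))

∣p∪q∣≡∣p∣+∣q∣ : Empty (p ∩ q) → ∣ p ∪ q ∣ ≡ ∣ p ∣ + ∣ q ∣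
∣p∪q∣≡∣p∣+∣q∣ {p = p} {q = q} disjoint = begin
  ∣ p ∪ q ∣             ≡⟨ sym (+-identityʳ _) ⟩
  ∣ p ∪ q ∣ + 0         ≡⟨ cong (∣ p ∪ q ∣ +_) (sym (Empty⇒∣p∣≡0 disjoint)) ⟩
  ∣ p ∪ q ∣ + ∣ p ∩ q ∣ ≡⟨ ∣p∪q∣+∣p∩q∣≡∣p∣+∣q∣ p q ⟩
  ∣ p ∣ + ∣ q ∣         ∎
  where open ≡-Reasoning

∣⁅x⁆∪⁅y⁆∣≡2 : ∀ (x y : Fin n) → x ≢ y → ∣ ⁅ x ⁆ ∪ ⁅ y ⁆ ∣ ≡ 2
∣⁅x⁆∪⁅y⁆∣≡2 x y x≢y =
  trans (∣p∪q∣≡∣p∣+∣q∣ disjoint) (cong₂ _+_ (∣⁅x⁆∣≡1 x) (∣⁅x⁆∣≡1 y))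
  where
  disjoint : Empty (⁅ x ⁆ ∩ ⁅ y ⁆)
  disjoint (z , z∈) with x∈p∩q⁻ ⁅ x ⁆ ⁅ y ⁆ z∈
  ... | z∈⁅x⁆ , z∈⁅y⁆ = x≢y (trans (sym (x∈⁅y⁆⇒x≡y x z∈⁅x⁆)) (x∈⁅y⁆⇒x≡y y z∈⁅y⁆))

∣p∣≤1 : (∀ {x y} → x ∈ p → y ∈ p → x ≡ y) → ∣ p ∣ ≤ 1
∣p∣≤1 {p = p} unique with nonempty? p
... | no  empty      = subst (_≤ 1) (sym (Empty⇒∣p∣≡0 empty)) z≤n
... | yes (x , x∈p) = subst (∣ p ∣ ≤_) (∣⁅x⁆∣≡1 x) (p⊆q⇒∣p∣≤∣q∣ p⊆⁅x⁆)
  where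
  p⊆⁅x⁆ : p ⊆ ⁅ x ⁆
  p⊆⁅x⁆ y∈p = subst (_∈ ⁅ x ⁆) (unique x∈p y∈p) (x∈⁅x⁆ x)

∣p-x∣+1≡∣p∣ : x ∈ p → ∣ p - x ∣ + 1 ≡ ∣ p ∣
∣p-x∣+1≡∣p∣ {x = x} {p = p} x∈p = begin
  ∣ p - x ∣ + 1             ≡⟨ cong (∣ p - x ∣ +_) (∣⁅x⁆∣≡1 x) ⟨
  ∣ p - x ∣ + ∣ ⁅ x ⁆ ∣     ≡⟨ cong (λ s → ∣ p - x ∣ + ∣ s ∣) p∩⁅x⁆≡⁅x⁆ ⟨
  ∣ p - x ∣ + ∣ p ∩ ⁅ x ⁆ ∣ ≡⟨ ∣p─q∣+∣p∩q∣≡∣p∣ p ⁅ x ⁆ ⟩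
  ∣ p ∣                     ∎
  where
  open ≡-Reasoning
  p∩⁅x⁆≡⁅x⁆ : p ∩ ⁅ x ⁆ ≡ ⁅ x ⁆
  p∩⁅x⁆≡⁅x⁆ = ⊆-antisym (p∩q⊆q p ⁅ x ⁆)
    (λ y∈⁅x⁆ → x∈p∩q⁺ (subst (_∈ p) (sym (x∈⁅y⁆⇒x≡y x y∈⁅x⁆)) x∈p , y∈⁅x⁆))

p⊆p-x∪⁅x⁆ : ∀ (p : Subset n) x → p ⊆ (p - x) ∪ ⁅ x ⁆
p⊆p-x∪⁅x⁆ p x {y} y∈p with y ≟ x
... | yes refl = x∈p∪q⁺ (inj₂ (x∈⁅x⁆ x))
... | no  y≢x  = x∈p∪q⁺ (inj₁ (x∈p∧x≢y⇒x∈p-y y∈p y≢x))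

p⊆q⇒p-x⊆q-x : p ⊆ q → p - x ⊆ q - x
p⊆q⇒p-x⊆q-x {p = p} {q = q} {x = x} p⊆q y∈ =
  x∈p∧x∉q⇒x∈p─q (p⊆q (proj₁ (x∈p─q⁻ p ⁅ x ⁆ y∈))) (proj₂ (x∈p─q⁻ p ⁅ x ⁆ y∈))

∣p∣≡∣q∣⇒∣p─q∣≡∣q─p∣ : ∀ (p q : Subset n) → ∣ p ∣ ≡ ∣ q ∣ → ∣ p ─ q ∣ ≡ ∣ q ─ p ∣
∣p∣≡∣q∣⇒∣p─q∣≡∣q─p∣ p q ∣p∣≡∣q∣ = +-cancelʳ-≡ ∣ p ∩ q ∣ _ _ (begin
  ∣ p ─ q ∣ + ∣ p ∩ q ∣ ≡⟨ ∣p─q∣+∣p∩q∣≡∣p∣ p q ⟩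
  ∣ p ∣                 ≡⟨ ∣p∣≡∣q∣ ⟩
  ∣ q ∣                 ≡⟨ ∣p─q∣+∣p∩q∣≡∣p∣ q p ⟨
  ∣ q ─ p ∣ + ∣ q ∩ p ∣ ≡⟨ cong (λ s → ∣ q ─ p ∣ + ∣ s ∣) (∩-comm q p) ⟩
  ∣ q ─ p ∣ + ∣ p ∩ q ∣ ∎)
  where open ≡-Reasoning

Empty[p─q]⇒p⊆q : Empty (p ─ q) → p ⊆ q
Empty[p─q]⇒p⊆q {q = q} empty {x} x∈p with x ∈? q
... | yes x∈q = x∈q
... | no  x∉q = contradiction (x , x∈p∧x∉q⇒x∈p─q x∈p x∉q) empty

Nonempty[p─q]⇒Nonempty[q─p] : ∀ (p q : Subset n) → ∣ p ∣ ≡ ∣ q ∣ → Nonempty (p ─ q) → Nonempty (q ─ p)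
Nonempty[p─q]⇒Nonempty[q─p] p q ∣p∣≡∣q∣ =
  ∣p∣>0⇒Nonempty ∘ subst (0 <_) (∣p∣≡∣q∣⇒∣p─q∣≡∣q─p∣ p q ∣p∣≡∣q∣) ∘ Nonempty⇒∣p∣>0

∣p∣≡∣q∣∧Empty[p─q]⇒p≡q : ∀ (p q : Subset n) → ∣ p ∣ ≡ ∣ q ∣ → Empty (p ─ q) → p ≡ q
∣p∣≡∣q∣∧Empty[p─q]⇒p≡q p q ∣p∣≡∣q∣ empty =
  ⊆-antisym (Empty[p─q]⇒p⊆q empty) (Empty[p─q]⇒p⊆q empty′)
  where
  empty′ : Empty (q ─ p)
  empty′ nonempty = <⇒≢ (Nonempty⇒∣p∣>0 nonempty)
    (sym (trans (sym (∣p∣≡∣q∣⇒∣p─q∣≡∣q─p∣ p q ∣p∣≡∣q∣)) (Empty⇒∣p∣≡0 empty)))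

T-lookup⁻ : T (lookup p x) → x ∈ p
T-lookup⁻ {p = p} {x = x} t = lookup⇒[]= x p (Equivalence.to T-≡ t)

T-lookup⁺ : x ∈ p → T (lookup p x)
T-lookup⁺ x∈p = Equivalence.from T-≡ ([]=⇒lookup x∈p)

∈-tabulate⁻ : ∀ {f : Fin n → Bool} → x ∈ tabulate f → T (f x)
∈-tabulate⁻ {x = x} {f = f} x∈ = subst T (lookup∘tabulate f x) (T-lookup⁺ x∈)

∈-tabulate⁺ : ∀ {f : Fin n → Bool} → T (f x) → x ∈ tabulate f
∈-tabulate⁺ {x = x} {f = f} t = T-lookup⁻ (subst T (sym (lookup∘tabulate f x)) t)

T-anyFin⁻ : ∀ {f : Fin n → Bool} → T (anyFin f) → ∃ λ i → T (f i)
T-anyFin⁻ {n = suc n} t with Equivalence.to T-∨ t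
... | inj₁ t₀ = Fin.zero , t₀
... | inj₂ t₊ = Product.map Fin.suc id (T-anyFin⁻ t₊)

T-anyFin⁺ : ∀ {f : Fin n → Bool} (i : Fin n) → T (f i) → T (anyFin f)
T-anyFin⁺ Fin.zero    t = Equivalence.from T-∨ (inj₁ t)
T-anyFin⁺ (Fin.suc i) t = Equivalence.from T-∨ (inj₂ (T-anyFin⁺ i t))

-- Token jumps

jump : Subset n → Fin n → Fin n → Subset n
jump X u w = (X - u) ∪ ⁅ w ⁆

∈-jump⁻ : x ∈ jump X u w → x ∈ X - u ⊎ x ≡ w
∈-jump⁻ {X = X} {u = u} {w = w} x∈ = Sum.map₂ (x∈⁅y⁆⇒x≡y w) (x∈p∪q⁻ (X - u) ⁅ w ⁆ x∈)

w∈jump : w ∈ jump X u w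
w∈jump {w = w} = x∈p∪q⁺ (inj₂ (x∈⁅x⁆ w))

u∉jump : u ≢ w → u ∉ jump X u w
u∉jump {u = u} u≢w u∈ with ∈-jump⁻ u∈
... | inj₁ u∈X-u = proj₂ (x∈p─q⁻ _ ⁅ u ⁆ u∈X-u) (x∈⁅x⁆ u)
... | inj₂ u≡w   = u≢w u≡w

jump∪⊆ : w ∈ Y → jump X u w ∪ Y ⊆ (X - u) ∪ Y
jump∪⊆ {w = w} {Y = Y} {X = X} {u = u} w∈Y x∈ with x∈p∪q⁻ (jump X u w) Y x∈
... | inj₂ x∈Y = x∈p∪q⁺ (inj₂ x∈Y)
... | inj₁ x∈J with ∈-jump⁻ x∈J
...   | inj₁ x∈X-u = x∈p∪q⁺ (inj₁ x∈X-u)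
...   | inj₂ refl  = x∈p∪q⁺ (inj₂ w∈Y)

∣jump∣ : u ∈ X → w ∉ X → ∣ jump X u w ∣ ≡ ∣ X ∣
∣jump∣ {u = u} {X = X} {w = w} u∈X w∉X =
  trans (∣p∪q∣≡∣p∣+∣q∣ disjoint) (trans (cong (∣ X - u ∣ +_) (∣⁅x⁆∣≡1 w)) (∣p-x∣+1≡∣p∣ u∈X))
  where
  disjoint : Empty ((X - u) ∩ ⁅ w ⁆)
  disjoint (x , x∈) with x∈p∩q⁻ (X - u) ⁅ w ⁆ x∈
  ... | x∈X-u , x∈⁅w⁆ with x∈⁅y⁆⇒x≡y w x∈⁅w⁆
  ... | refl = w∉X (proj₁ (x∈p─q⁻ X ⁅ u ⁆ x∈X-u))

X─jump≡⁅u⁆ : u ∈ X → w ∉ X → X ─ jump X u w ≡ ⁅ u ⁆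
X─jump≡⁅u⁆ {u = u} {X = X} {w = w} u∈X w∉X = ⊆-antisym ⊆⁅u⁆ ⁅u⁆⊆
  where
  ⊆⁅u⁆ : X ─ jump X u w ⊆ ⁅ u ⁆
  ⊆⁅u⁆ {x} x∈ with x∈p─q⁻ X (jump X u w) x∈ | x ≟ u
  ... | _         , _   | yes refl = x∈⁅x⁆ u
  ... | x∈X , x∉J | no x≢u   = contradiction (x∈p∪q⁺ (inj₁ (x∈p∧x≢y⇒x∈p-y x∈X x≢u))) x∉J
  ⁅u⁆⊆ : ⁅ u ⁆ ⊆ X ─ jump X u w
  ⁅u⁆⊆ x∈⁅u⁆ with x∈⁅y⁆⇒x≡y u x∈⁅u⁆
  ... | refl = x∈p∧x∉q⇒x∈p─q u∈X (u∉jump λ { refl → w∉X u∈X })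

jump─X≡⁅w⁆ : w ∉ X → jump X u w ─ X ≡ ⁅ w ⁆
jump─X≡⁅w⁆ {w = w} {X = X} {u = u} w∉X = ⊆-antisym ⊆⁅w⁆ ⁅w⁆⊆
  where
  ⊆⁅w⁆ : jump X u w ─ X ⊆ ⁅ w ⁆
  ⊆⁅w⁆ x∈ with x∈p─q⁻ (jump X u w) X x∈
  ... | x∈J , x∉X with ∈-jump⁻ x∈J
  ...   | inj₁ x∈X-u = contradiction (proj₁ (x∈p─q⁻ X ⁅ u ⁆ x∈X-u)) x∉X
  ...   | inj₂ refl  = x∈⁅x⁆ w
  ⁅w⁆⊆ : ⁅ w ⁆ ⊆ jump X u w ─ X
  ⁅w⁆⊆ x∈⁅w⁆ with x∈⁅y⁆⇒x≡y w x∈⁅w⁆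
  ... | refl = x∈p∧x∉q⇒x∈p─q w∈jump w∉X

jump─⊂ : u ∈ X ─ Y → w ∈ Y ─ X → jump X u w ─ Y ⊂ X ─ Y
jump─⊂ {u = u} {X = X} {Y = Y} {w = w} u∈X─Y w∈Y─X = ⊆X─Y , u , u∈X─Y , u∉
  where
  ⊆X─Y : jump X u w ─ Y ⊆ X ─ Y
  ⊆X─Y x∈ with x∈p─q⁻ (jump X u w) Y x∈
  ... | x∈J , x∉Y with ∈-jump⁻ x∈J
  ...   | inj₁ x∈X-u = x∈p∧x∉q⇒x∈p─q (proj₁ (x∈p─q⁻ X ⁅ u ⁆ x∈X-u)) x∉Y
  ...   | inj₂ refl  = contradiction (proj₁ (x∈p─q⁻ Y X w∈Y─X)) x∉Y
  u∉ : u ∉ jump X u w ─ Y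
  u∉ = u∉jump (λ { refl → proj₂ (x∈p─q⁻ Y X w∈Y─X) (proj₁ (x∈p─q⁻ X Y u∈X─Y)) })
     ∘ proj₁ ∘ x∈p─q⁻ (jump X u w) Y

module _ {n : ℕ} (G : Graph n) where

  Adj-sym : Adj G u w → Adj G w u
  Adj-sym {u = u} {w = w} = subst T (Graph.sym G u w)

  Adj⇒≢ : Adj G u w → u ≢ w
  Adj⇒≢ {u = u} uu refl = subst T (irrefl G u) uu

  ∈-nbhd⁻ : x ∈ nbhd G v → Adj G v x
  ∈-nbhd⁻ = ∈-tabulate⁻

  ∈-closedNbhd⁻ : x ∈ closedNbhd G X → x ∈ X ⊎ ∃ λ u → u ∈ X × Adj G u x
  ∈-closedNbhd⁻ x∈ with Equivalence.to T-∨ (∈-tabulate⁻ x∈)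
  ... | inj₁ t = inj₁ (T-lookup⁻ t)
  ... | inj₂ t = inj₂ (Product.map id (Product.map T-lookup⁻ id ∘ Equivalence.to T-∧) (T-anyFin⁻ t))

  X⊆closedNbhd : X ⊆ closedNbhd G X
  X⊆closedNbhd x∈X = ∈-tabulate⁺ (Equivalence.from T-∨ (inj₁ (T-lookup⁺ x∈X)))

  Adj⇒∈-closedNbhd : u ∈ X → Adj G u x → x ∈ closedNbhd G X
  Adj⇒∈-closedNbhd {u = u} u∈X ux =
    ∈-tabulate⁺ (Equivalence.from T-∨ (inj₂ (T-anyFin⁺ u (Equivalence.from T-∧ (T-lookup⁺ u∈X , ux)))))

  ∉-closedNbhd⇒¬Adj : x ∉ closedNbhd G X → u ∈ X → ¬ Adj G u x
  ∉-closedNbhd⇒¬Adj x∉ u∈X ux = x∉ (Adj⇒∈-closedNbhd u∈X ux)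

  ∈-closedNbhd⁅⁆⁻ : x ∈ closedNbhd G ⁅ u ⁆ → x ≡ u ⊎ Adj G u x
  ∈-closedNbhd⁅⁆⁻ {u = u} x∈ with ∈-closedNbhd⁻ x∈
  ... | inj₁ x∈⁅u⁆             = inj₁ (x∈⁅y⁆⇒x≡y u x∈⁅u⁆)
  ... | inj₂ (w , w∈⁅u⁆ , wx) = inj₂ (subst (λ z → Adj G z _) (x∈⁅y⁆⇒x≡y u w∈⁅u⁆) wx)

  closedNbhd-mono : X ⊆ Y → closedNbhd G X ⊆ closedNbhd G Y
  closedNbhd-mono X⊆Y x∈ with ∈-closedNbhd⁻ x∈
  ... | inj₁ x∈X             = X⊆closedNbhd (X⊆Y x∈X)
  ... | inj₂ (u , u∈X , ux) = Adj⇒∈-closedNbhd (X⊆Y u∈X) ux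

  closedNbhd-∪ : closedNbhd G (X ∪ Y) ⊆ closedNbhd G X ∪ closedNbhd G Y
  closedNbhd-∪ {X = X} {Y = Y} x∈ with ∈-closedNbhd⁻ x∈
  ... | inj₁ x∈X∪Y = x∈p∪q⁺ (Sum.map X⊆closedNbhd X⊆closedNbhd (x∈p∪q⁻ X Y x∈X∪Y))
  ... | inj₂ (u , u∈X∪Y , ux) =
    x∈p∪q⁺ (Sum.map (λ u∈ → Adj⇒∈-closedNbhd u∈ ux) (λ u∈ → Adj⇒∈-closedNbhd u∈ ux) (x∈p∪q⁻ X Y u∈X∪Y))

  closedNbhd-Empty : Empty X → Empty (closedNbhd G X)
  closedNbhd-Empty empty (x , x∈) with ∈-closedNbhd⁻ x∈
  ... | inj₁ x∈X            = empty (x , x∈X)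
  ... | inj₂ (u , u∈X , _) = empty (u , u∈X)

  IndependentSet-⊆ : Y ⊆ X → IndependentSet G X → IndependentSet G Y
  IndependentSet-⊆ Y⊆X ind x y x∈Y y∈Y = ind x y (Y⊆X x∈Y) (Y⊆X y∈Y)

  IndependentSet-∪ : IndependentSet G X → IndependentSet G Y →
                     (∀ {x y} → x ∈ X → y ∈ Y → ¬ Adj G x y) → IndependentSet G (X ∪ Y)
  IndependentSet-∪ {X = X} {Y = Y} indX indY cross x y x∈ y∈
    with x∈p∪q⁻ X Y x∈ | x∈p∪q⁻ X Y y∈
  ... | inj₁ x∈X | inj₁ y∈X = indX x y x∈X y∈X
  ... | inj₁ x∈X | inj₂ y∈Y = cross x∈X y∈Y
  ... | inj₂ x∈Y | inj₁ y∈X = cross y∈X x∈Y ∘ Adj-sym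
  ... | inj₂ x∈Y | inj₂ y∈Y = indY x y x∈Y y∈Y

  -- Reconfiguration sequences

  Δ-comm : ∀ (X Y : Subset n) → _Δ_ G X Y ≡ _Δ_ G Y X
  Δ-comm X Y = ∪-comm (X ─ Y) (Y ─ X)

  _∷ʳ_ : ReconfSeq G k X Y ℓ → (∣ _Δ_ G Y Z ∣ ≡ 2) × TJConfig G k Z → ReconfSeq G k X Z (suc ℓ)
  done cX       ∷ʳ (Δ≡2 , cZ) = step cX Δ≡2 (done cZ)
  step cX Δ≡2 r ∷ʳ last        = step cX Δ≡2 (r ∷ʳ last)

  reverse : ReconfSeq G k X Y ℓ → ReconfSeq G k Y X ℓ
  reverse (done cX) = done cX
  reverse (step {S = X} {S′ = X′} cX Δ≡2 r) = reverse r ∷ʳ (trans (cong ∣_∣ (Δ-comm X′ X)) Δ≡2 , cX)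

  _++_ : ReconfSeq G k X Y ℓ → ReconfSeq G k Y Z m → ReconfSeq G k X Z (ℓ + m)
  done _        ++ r′ = r′
  step cX Δ≡2 r ++ r′ = step cX Δ≡2 (r ++ r′)

  ∣Δ-jump∣≡2 : u ∈ X → w ∉ X → ∣ _Δ_ G X (jump X u w) ∣ ≡ 2
  ∣Δ-jump∣≡2 {u = u} {X = X} {w = w} u∈X w∉X = begin
    ∣ (X ─ jump X u w) ∪ (jump X u w ─ X) ∣ ≡⟨ cong₂ (λ s t → ∣ s ∪ t ∣) (X─jump≡⁅u⁆ u∈X w∉X) (jump─X≡⁅w⁆ w∉X) ⟩
    ∣ ⁅ u ⁆ ∪ ⁅ w ⁆ ∣                        ≡⟨ ∣⁅x⁆∪⁅y⁆∣≡2 u w (λ { refl → w∉X u∈X }) ⟩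
    2                                        ∎
    where open ≡-Reasoning

  jump-config : TJConfig G k X → u ∈ X → w ∉ X → IndependentSet G (jump X u w) →
                TJConfig G k (jump X u w)
  jump-config (_ , ∣X∣≡k) u∈X w∉X ind = ind , trans (∣jump∣ u∈X w∉X) ∣X∣≡k

  reconf-≤∣X─Y∣ : TJConfig G k X → TJConfig G k Y → IndependentSet G (X ∪ Y) →
          ∃ λ ℓ → ℓ ≤ ∣ X ─ Y ∣ × ReconfSeq G k X Y ℓ
  reconf-≤∣X─Y∣ {k = k} {X = X} {Y = Y} cX cY X∪Y-ind = go _ cX X∪Y-ind ≤-refl
    where
    go : ∀ m {X} → TJConfig G k X → IndependentSet G (X ∪ Y) → ∣ X ─ Y ∣ ≤ m →
         ∃ λ ℓ → ℓ ≤ m × ReconfSeq G k X Y ℓ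
    go m {X} cX X∪Y-ind ∣X─Y∣≤m with nonempty? (X ─ Y) | m
    ... | no empty | _ = 0 , z≤n , subst (λ Z → ReconfSeq G k X Z 0) X≡Y (done cX)
      where
      X≡Y : X ≡ Y
      X≡Y = ∣p∣≡∣q∣∧Empty[p─q]⇒p≡q X Y (trans (proj₂ cX) (sym (proj₂ cY))) empty
    ... | yes nonempty | zero = contradiction ∣X─Y∣≤m (<⇒≱ (Nonempty⇒∣p∣>0 nonempty))
    ... | yes (u , u∈X─Y) | suc m
      with w , w∈Y─X ← Nonempty[p─q]⇒Nonempty[q─p] X Y (trans (proj₂ cX) (sym (proj₂ cY))) (u , u∈X─Y) =
      Product.map suc (Product.map s≤s (step cX (∣Δ-jump∣≡2 u∈X w∉X)))
        (go m (jump-config cX u∈X w∉X X′-ind) X′∪Y-ind ∣X′─Y∣≤m)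
      where
      X′ : Subset n
      X′ = jump X u w
      u∈X : u ∈ X
      u∈X = proj₁ (x∈p─q⁻ X Y u∈X─Y)
      w∈Y : w ∈ Y
      w∈Y = proj₁ (x∈p─q⁻ Y X w∈Y─X)
      w∉X : w ∉ X
      w∉X = proj₂ (x∈p─q⁻ Y X w∈Y─X)
      X′∪Y-ind : IndependentSet G (X′ ∪ Y)
      X′∪Y-ind = IndependentSet-⊆ (⊆-trans (jump∪⊆ w∈Y) (∪-monoˡ-⊆ (p─q⊆p X ⁅ u ⁆))) X∪Y-ind
      X′-ind : IndependentSet G X′
      X′-ind = IndependentSet-⊆ (p⊆p∪q Y) X′∪Y-ind
      ∣X′─Y∣≤m : ∣ X′ ─ Y ∣ ≤ m
      ∣X′─Y∣≤m = ≤-pred (≤-trans (p⊂q⇒∣p∣<∣q∣ (jump─⊂ u∈X─Y w∈Y─X)) ∣X─Y∣≤m)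

  -- If v ∈ X, its token first jumps into Y ─ X; afterwards X and Y share a token, so fewer than k remain to move.
  reconf-≤k : v ∉ Y → TJConfig G k X → TJConfig G k Y → IndependentSet G ((X - v) ∪ Y) →
              ∃ λ ℓ → ℓ ≤ k × ReconfSeq G k X Y ℓ
  reconf-≤k {v = v} {Y = Y} {k = k} {X = X} v∉Y cX cY ind with v ∈? X
  ... | no v∉X = Product.map₂ (Product.map₁ (λ ℓ≤ → ≤-trans ℓ≤ ∣X─Y∣≤k)) (reconf-≤∣X─Y∣ cX cY X∪Y-ind)
    where
    ∣X─Y∣≤k : ∣ X ─ Y ∣ ≤ k
    ∣X─Y∣≤k = subst (∣ X ─ Y ∣ ≤_) (proj₂ cX) (∣p─q∣≤∣p∣ X Y)
    X⊆X-v : X ⊆ X - v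
    X⊆X-v x∈X = x∈p∧x≢y⇒x∈p-y x∈X (λ { refl → v∉X x∈X })
    X∪Y-ind : IndependentSet G (X ∪ Y)
    X∪Y-ind = IndependentSet-⊆ (∪-monoˡ-⊆ X⊆X-v) ind
  ... | yes v∈X
    with w , w∈Y─X ← Nonempty[p─q]⇒Nonempty[q─p] X Y (trans (proj₂ cX) (sym (proj₂ cY)))
                       (v , x∈p∧x∉q⇒x∈p─q v∈X v∉Y) =
    Product.map suc (Product.map 1+ℓ≤k (step cX (∣Δ-jump∣≡2 v∈X w∉X))) (reconf-≤∣X─Y∣ cX′ cY X′∪Y-ind)
    where
    X′ : Subset n
    X′ = jump X v w
    w∈Y : w ∈ Y
    w∈Y = proj₁ (x∈p─q⁻ Y X w∈Y─X)
    w∉X : w ∉ X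
    w∉X = proj₂ (x∈p─q⁻ Y X w∈Y─X)
    X′∪Y-ind : IndependentSet G (X′ ∪ Y)
    X′∪Y-ind = IndependentSet-⊆ (jump∪⊆ w∈Y) ind
    cX′ : TJConfig G k X′
    cX′ = jump-config cX v∈X w∉X (IndependentSet-⊆ (p⊆p∪q Y) X′∪Y-ind)
    1+ℓ≤k : ∀ {ℓ} → ℓ ≤ ∣ X′ ─ Y ∣ → suc ℓ ≤ k
    1+ℓ≤k ℓ≤ = ≤-trans (s≤s ℓ≤)
      (subst (_ ≤_) (proj₂ cX′) (p∩q≢∅⇒∣p─q∣<∣p∣ X′ Y (w , x∈p∩q⁺ (w∈jump , w∈Y))))

  reconf-≤2k : v ∉ Z → TJConfig G k Z → TJConfig G k X → TJConfig G k Y →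
               IndependentSet G ((X - v) ∪ Z) → IndependentSet G ((Y - v) ∪ Z) →
               ∃ λ ℓ → ℓ ≤ 2 * k × ReconfSeq G k X Y ℓ
  reconf-≤2k {k = k} v∉Z cZ cX cY indX indY
    with ℓ₁ , ℓ₁≤k , X⇝Z ← reconf-≤k v∉Z cX cZ indX
       | ℓ₂ , ℓ₂≤k , Y⇝Z ← reconf-≤k v∉Z cY cZ indY =
    ℓ₁ + ℓ₂ , subst (ℓ₁ + ℓ₂ ≤_) (cong (k +_) (sym (+-identityʳ k))) (+-mono-≤ ℓ₁≤k ℓ₂≤k) ,
    X⇝Z ++ reverse Y⇝Z

  -- Neighbourhoods in {C₃,C₄}-free induced subgraphs

  induced-C3 : a ∈ W → b ∈ W → c ∈ W → Adj G a b → Adj G b c → Adj G c a → HasInducedC3 G W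
  induced-C3 a∈W b∈W c∈W ab bc ca =
    _ , _ , _ , a∈W , b∈W , c∈W , Adj⇒≢ ab , ≢-sym (Adj⇒≢ ca) , Adj⇒≢ bc , ab , bc , ca

  induced-C4 : a ∈ W → b ∈ W → c ∈ W → d ∈ W → a ≢ c → b ≢ d →
               Adj G a b → Adj G b c → Adj G c d → Adj G d a → ¬ Adj G a c → ¬ Adj G b d →
               HasInducedC4 G W
  induced-C4 a∈W b∈W c∈W d∈W a≢c b≢d ab bc cd da ¬ac ¬bd =
    _ , _ , _ , _ , a∈W , b∈W , c∈W , d∈W ,
    Adj⇒≢ ab , a≢c , ≢-sym (Adj⇒≢ da) , Adj⇒≢ bc , b≢d , Adj⇒≢ cd ,
    ab , bc , cd , da , ¬ac , ¬bd

  ∈-nbhd∩⁻ : x ∈ nbhd G v ∩ W → Adj G v x × x ∈ W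
  ∈-nbhd∩⁻ {v = v} {W = W} x∈ = Product.map₁ ∈-nbhd⁻ (x∈p∩q⁻ (nbhd G v) W x∈)

  ∈-nbhd∩⁺ : Adj G v x → x ∈ W → x ∈ nbhd G v ∩ W
  ∈-nbhd∩⁺ vx x∈W = x∈p∩q⁺ (∈-tabulate⁺ vx , x∈W)

  nbhd∩-independent : ¬ HasInducedC3 G W → v ∈ W → IndependentSet G (nbhd G v ∩ W)
  nbhd∩-independent noC3 v∈W x y x∈ y∈ xy with ∈-nbhd∩⁻ x∈ | ∈-nbhd∩⁻ y∈
  ... | vx , x∈W | vy , y∈W = noC3 (induced-C3 v∈W x∈W y∈W vx xy (Adj-sym vy))

  ∈-nbhd∩closedNbhd⁅⁆-unique : C3C4Free G W → v ∈ W → b ∈ W → b ≢ v →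
    x ∈ (nbhd G v ∩ W) ∩ closedNbhd G ⁅ b ⁆ → y ∈ (nbhd G v ∩ W) ∩ closedNbhd G ⁅ b ⁆ → x ≡ y
  ∈-nbhd∩closedNbhd⁅⁆-unique {W = W} {v = v} {b = b} {x = x} {y = y} (noC3 , noC4) v∈W b∈W b≢v x∈ y∈
    with x ≟ y
  ... | yes x≡y = x≡y
  ... | no  x≢y
    with x∈p∩q⁻ (nbhd G v ∩ W) _ x∈ | x∈p∩q⁻ (nbhd G v ∩ W) _ y∈
  ... | x∈P , x∈N[b] | y∈P , y∈N[b]
    with ∈-closedNbhd⁅⁆⁻ {u = b} x∈N[b] | ∈-closedNbhd⁅⁆⁻ {u = b} y∈N[b]
  ... | inj₁ refl | inj₁ refl = contradiction refl x≢y
  ... | inj₁ refl | inj₂ xy   = contradiction xy (nbhd∩-independent noC3 v∈W x y x∈P y∈P)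
  ... | inj₂ yx   | inj₁ refl = contradiction yx (nbhd∩-independent noC3 v∈W y x y∈P x∈P)
  ... | inj₂ bx   | inj₂ by   = contradiction
    (induced-C4 v∈W x∈W b∈W y∈W (≢-sym b≢v) x≢y vx (Adj-sym bx) by (Adj-sym vy) ¬vb (independent x y x∈P y∈P))
    noC4
    where
    independent : IndependentSet G (nbhd G v ∩ W)
    independent = nbhd∩-independent noC3 v∈W
    vx : Adj G v x
    vx = proj₁ (∈-nbhd∩⁻ x∈P)
    vy : Adj G v y
    vy = proj₁ (∈-nbhd∩⁻ y∈P)
    x∈W : x ∈ W
    x∈W = proj₂ (∈-nbhd∩⁻ x∈P)
    y∈W : y ∈ W
    y∈W = proj₂ (∈-nbhd∩⁻ y∈P)
    ¬vb : ¬ Adj G v b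
    ¬vb vb = independent b x (∈-nbhd∩⁺ vb b∈W) x∈P bx

  ∣nbhd∩closedNbhd⁅⁆∣≤1 : C3C4Free G W → v ∈ W → b ∈ W → b ≢ v →
                          ∣ (nbhd G v ∩ W) ∩ closedNbhd G ⁅ b ⁆ ∣ ≤ 1
  ∣nbhd∩closedNbhd⁅⁆∣≤1 free v∈W b∈W b≢v = ∣p∣≤1 (∈-nbhd∩closedNbhd⁅⁆-unique free v∈W b∈W b≢v)

  ∣P∩N[B]∣≤∣B∣ : ∀ (P B : Subset n) → (∀ {b} → b ∈ B → ∣ P ∩ closedNbhd G ⁅ b ⁆ ∣ ≤ 1) →
                ∣ P ∩ closedNbhd G B ∣ ≤ ∣ B ∣
  ∣P∩N[B]∣≤∣B∣ P B each = go _ ⊆-refl ≤-refl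
    where
    open ≤-Reasoning
    go : ∀ m {C} → C ⊆ B → ∣ C ∣ ≤ m → ∣ P ∩ closedNbhd G C ∣ ≤ m
    go m {C} C⊆B ∣C∣≤m with nonempty? C | m
    ... | no empty | _ =
      ≤-trans (≤-reflexive (Empty⇒∣p∣≡0 (closedNbhd-Empty empty ∘ Product.map₂ (proj₂ ∘ x∈p∩q⁻ P _)))) z≤n
    ... | yes nonempty | zero = contradiction ∣C∣≤m (<⇒≱ (Nonempty⇒∣p∣>0 nonempty))
    ... | yes (b , b∈C) | suc m = begin
      ∣ P ∩ closedNbhd G C ∣
        ≤⟨ p⊆q⇒∣p∣≤∣q∣ (∩-monoʳ-⊆ P (⊆-trans (closedNbhd-mono (p⊆p-x∪⁅x⁆ C b)) (closedNbhd-∪ {X = C - b} {Y = ⁅ b ⁆}))) ⟩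
      ∣ P ∩ (closedNbhd G (C - b) ∪ closedNbhd G ⁅ b ⁆) ∣
        ≡⟨ cong ∣_∣ (∩-distribˡ-∪ P _ _) ⟩
      ∣ (P ∩ closedNbhd G (C - b)) ∪ (P ∩ closedNbhd G ⁅ b ⁆) ∣
        ≤⟨ ∣p∪q∣≤∣p∣+∣q∣ (P ∩ closedNbhd G (C - b)) (P ∩ closedNbhd G ⁅ b ⁆) ⟩
      ∣ P ∩ closedNbhd G (C - b) ∣ + ∣ P ∩ closedNbhd G ⁅ b ⁆ ∣
        ≤⟨ +-mono-≤ (go m (⊆-trans (p─q⊆p C ⁅ b ⁆) C⊆B) ∣C-b∣≤m) (each (C⊆B b∈C)) ⟩
      m + 1
        ≡⟨ +-comm m 1 ⟩
      suc m ∎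
      where
      ∣C-b∣≤m : ∣ C - b ∣ ≤ m
      ∣C-b∣≤m = ≤-pred (≤-trans (x∈p⇒∣p-x∣<∣p∣ b∈C) ∣C∣≤m)

  freeNbhd : Subset n → Fin n → Subset n → Subset n
  freeNbhd W v B = (nbhd G v ∩ W) ─ closedNbhd G B

  ∣nbhd∩W∣≤∣freeNbhd∣+∣B∣ : C3C4Free G W → v ∈ W → B ⊆ W → v ∉ B →
                            ∣ nbhd G v ∩ W ∣ ≤ ∣ freeNbhd W v B ∣ + ∣ B ∣
  ∣nbhd∩W∣≤∣freeNbhd∣+∣B∣ {W = W} {v = v} {B = B} free v∈W B⊆W v∉B = begin
    ∣ P ∣                                         ≡⟨ ∣p─q∣+∣p∩q∣≡∣p∣ P (closedNbhd G B) ⟨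
    ∣ freeNbhd W v B ∣ + ∣ P ∩ closedNbhd G B ∣ ≤⟨ +-monoʳ-≤ ∣ freeNbhd W v B ∣ (∣P∩N[B]∣≤∣B∣ P B each) ⟩
    ∣ freeNbhd W v B ∣ + ∣ B ∣                  ∎
    where
    open ≤-Reasoning
    P : Subset n
    P = nbhd G v ∩ W
    each : ∀ {b} → b ∈ B → ∣ P ∩ closedNbhd G ⁅ b ⁆ ∣ ≤ 1
    each b∈B = ∣nbhd∩closedNbhd⁅⁆∣≤1 free v∈W (B⊆W b∈B) (λ { refl → v∉B b∈B })

  freeNbhd-independent : ¬ HasInducedC3 G W → v ∈ W → IndependentSet G (freeNbhd W v B)
  freeNbhd-independent {W = W} {v = v} {B = B} noC3 v∈W =
    IndependentSet-⊆ (p─q⊆p (nbhd G v ∩ W) (closedNbhd G B)) (nbhd∩-independent noC3 v∈W)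

  v∉freeNbhd : v ∉ freeNbhd W v B
  v∉freeNbhd {v = v} {W = W} {B = B} v∈ =
    Adj⇒≢ (proj₁ (∈-nbhd∩⁻ (proj₁ (x∈p─q⁻ (nbhd G v ∩ W) (closedNbhd G B) v∈)))) refl

  freeNbhd-¬Adj : u ∈ B → x ∈ freeNbhd W v B → ¬ Adj G u x
  freeNbhd-¬Adj {B = B} {W = W} {v = v} u∈B x∈ =
    ∉-closedNbhd⇒¬Adj (proj₂ (x∈p─q⁻ (nbhd G v ∩ W) (closedNbhd G B) x∈)) u∈B

  k≤∣freeNbhd∣ : C3C4Free G W → v ∈ W → B ⊆ W → v ∉ B →
                 ∣ B ∣ ≤ 2 * k → 3 * k ≤ ∣ nbhd G v ∩ W ∣ → k ≤ ∣ freeNbhd W v B ∣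
  k≤∣freeNbhd∣ {W = W} {v = v} {B = B} {k = k} free v∈W B⊆W v∉B ∣B∣≤2k 3k≤deg =
    +-cancelʳ-≤ (2 * k) k ∣ freeNbhd W v B ∣ (begin
      3 * k                          ≤⟨ 3k≤deg ⟩
      ∣ nbhd G v ∩ W ∣               ≤⟨ ∣nbhd∩W∣≤∣freeNbhd∣+∣B∣ free v∈W B⊆W v∉B ⟩
      ∣ freeNbhd W v B ∣ + ∣ B ∣     ≤⟨ +-monoʳ-≤ ∣ freeNbhd W v B ∣ ∣B∣≤2k ⟩
      ∣ freeNbhd W v B ∣ + 2 * k     ∎)
    where open ≤-Reasoning

  X-v∪freeNbhd-independent : IndependentSet G X → X - v ⊆ B → Z ⊆ freeNbhd W v B → IndependentSet G Z →
                             IndependentSet G ((X - v) ∪ Z)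
  X-v∪freeNbhd-independent {X = X} {v = v} X-ind X-v⊆B Z⊆F Z-ind =
    IndependentSet-∪ (IndependentSet-⊆ (p─q⊆p X ⁅ v ⁆) X-ind) Z-ind
      λ x∈X-v z∈Z → freeNbhd-¬Adj (X-v⊆B x∈X-v) (Z⊆F z∈Z)

lemma2 : (n : ℕ) (G : Graph n) (k : ℕ) (S T : Subset n) →
    1 ≤ k →
    IndependentSet G S → IndependentSet G T → ∣ S ∣ ≡ k → ∣ T ∣ ≡ k →
    C3C4Free G (closedNbhd G (S ∪ T)) →
    (∃ λ v → v ∈ closedNbhd G (S ∪ T) × 3 * k ≤ inducedDegree G (closedNbhd G (S ∪ T)) v) →
    ∃ λ ℓ → ℓ ≤ 2 * k × ReconfSeq G k S T ℓ
lemma2 n G k S T _ S-ind T-ind ∣S∣≡k ∣T∣≡k free (v , v∈J , 3k≤deg) =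
  via (subset-of-size k (freeNbhd G J v U-v) (k≤∣freeNbhd∣ G free v∈J U-v⊆J v∉U-v ∣U-v∣≤2k 3k≤deg))
  where
  U J U-v : Subset n
  U = S ∪ T
  J = closedNbhd G U
  U-v = U - v

  U-v⊆J : U-v ⊆ J
  U-v⊆J = X⊆closedNbhd G ∘ p─q⊆p U ⁅ v ⁆

  v∉U-v : v ∉ U-v
  v∉U-v v∈ = x∉⁅y⁆⇒x≢y (proj₂ (x∈p─q⁻ U ⁅ v ⁆ v∈)) refl

  ∣U-v∣≤2k : ∣ U-v ∣ ≤ 2 * k
  ∣U-v∣≤2k = begin
    ∣ U - v ∣     ≤⟨ ∣p─q∣≤∣p∣ U ⁅ v ⁆ ⟩
    ∣ S ∪ T ∣     ≤⟨ ∣p∪q∣≤∣p∣+∣q∣ S T ⟩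
    ∣ S ∣ + ∣ T ∣ ≡⟨ cong₂ _+_ ∣S∣≡k (trans ∣T∣≡k (sym (+-identityʳ k))) ⟩
    2 * k         ∎
    where open ≤-Reasoning

  via : (∃ λ Z → Z ⊆ freeNbhd G J v U-v × ∣ Z ∣ ≡ k) → ∃ λ ℓ → ℓ ≤ 2 * k × ReconfSeq G k S T ℓ
  via (Z , Z⊆F , ∣Z∣≡k) =
    reconf-≤2k G (v∉freeNbhd G {B = U-v} ∘ Z⊆F) (Z-ind , ∣Z∣≡k) (S-ind , ∣S∣≡k) (T-ind , ∣T∣≡k)
      (X-v∪freeNbhd-independent G S-ind (p⊆q⇒p-x⊆q-x (p⊆p∪q T)) Z⊆F Z-ind)
      (X-v∪freeNbhd-independent G T-ind (p⊆q⇒p-x⊆q-x (q⊆p∪q S T)) Z⊆F Z-ind)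
    where
    Z-ind : IndependentSet G Z
    Z-ind = IndependentSet-⊆ G Z⊆F (freeNbhd-independent G {B = U-v} (proj₁ free) v∈J)
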